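{- Let $p>q>2$ be prime numbers and $x,y$ positive integers. (i) If $x^p-y^q=1$, then $(x-1)^p\, q^{(p-1)q}>(y+1)^q$. (ii) If $x^p-y^q=-1$, then $(x+1)^p\, q^{(p-1)q}>(y-1)^q$. -}

module Defs where

{-# OPTIONS --safe #-}
-- If x^p = y^q + 1 then x ≥ 2, and doubling
-- bounds n + 1 ≤ 2n give
--   (y+1)^q ≤ 2^q y^q < 2^q x^p ≤ 2^(q+p) (x-1)^p ≤ q^((p-1)q) (x-1)^p,
-- the last step because q + p ≤ (p-1)q.  If x^p + 1 = y^q then already
--   (y-1)^q < y^q = x^p + 1 ≤ (x+1)^p.
module Submission where

open import Defs
open import Data.Nat using (ℕ; _+_; _*_; _∸_; _^_; _<_; _>_)
open import Data.Nat.Primality using (Prime)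
open import Data.Product using (_×_)
open import Relation.Binary.PropositionalEquality using (_≡_)

open import Data.Nat using (zero; suc; _≤_; _<?_; z<s; NonZero; >-nonZero)
open import Data.Nat.Properties
open import Data.Product using (_,_)
open import Relation.Binary.PropositionalEquality using (refl; sym; cong; module ≡-Reasoning)
open import Relation.Nullary using (yes; no; contradiction)
open import Algebra.Properties.CommutativeSemigroup *-commutativeSemigroup using (interchange)

^-distribʳ-* : ∀ m n o → (m * n) ^ o ≡ m ^ o * n ^ o
^-distribʳ-* m n zero    = refl
^-distribʳ-* m n (suc o) = begin
  m * n * (m * n) ^ o        ≡⟨ cong (m * n *_) (^-distribʳ-* m n o) ⟩
  m * n * (m ^ o * n ^ o)    ≡⟨ interchange m n (m ^ o) (n ^ o) ⟩
  m * m ^ o * (n * n ^ o)    ∎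
  where open ≡-Reasoning

n+1≤2*n : ∀ {n} → 0 < n → n + 1 ≤ 2 * n
n+1≤2*n {n} 0<n = begin
  n + 1        ≤⟨ +-monoʳ-≤ n 0<n ⟩
  n + n        ≡⟨ cong (n +_) (sym (+-identityʳ n)) ⟩
  2 * n        ∎
  where open ≤-Reasoning

[n+1]^k≤2^k*n^k : ∀ {n} → 0 < n → ∀ k → (n + 1) ^ k ≤ 2 ^ k * n ^ k
[n+1]^k≤2^k*n^k {n} 0<n k = begin
  (n + 1) ^ k    ≤⟨ ^-monoˡ-≤ k (n+1≤2*n 0<n) ⟩
  (2 * n) ^ k    ≡⟨ ^-distribʳ-* 2 n k ⟩
  2 ^ k * n ^ k  ∎
  where open ≤-Reasoning

n+m≤[m∸1]*n : ∀ {m n} → 2 < n → n < m → n + m ≤ (m ∸ 1) * n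
n+m≤[m∸1]*n {suc k} {n} 2<n n<m = begin
  n + suc k        ≤⟨ +-monoˡ-≤ (suc k) n≤k ⟩
  k + suc k        ≡⟨ +-suc k k ⟩
  1 + (k + k)      ≤⟨ +-monoˡ-≤ (k + k) (≤-trans (m<n⇒0<n 2<n) n≤k) ⟩
  k + (k + k)      ≡⟨ cong (λ i → k + (k + i)) (sym (+-identityʳ k)) ⟩
  3 * k            ≤⟨ *-monoˡ-≤ k 2<n ⟩
  n * k            ≡⟨ *-comm n k ⟩
  k * n            ∎
  where
  open ≤-Reasoning
  n≤k : n ≤ k
  n≤k = ≤-pred n<m

2^[n+m]≤n^[[m∸1]*n] : ∀ {m n} → 2 < n → n < m → 2 ^ (n + m) ≤ n ^ ((m ∸ 1) * n)
2^[n+m]≤n^[[m∸1]*n] {m} {n@(suc _)} 2<n n<m = begin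
  2 ^ (n + m)        ≤⟨ ^-monoˡ-≤ (n + m) (<⇒≤ 2<n) ⟩
  n ^ (n + m)        ≤⟨ ^-monoʳ-≤ n (n+m≤[m∸1]*n 2<n n<m) ⟩
  n ^ ((m ∸ 1) * n)  ∎
  where open ≤-Reasoning

x^p≡y^q+1⇒1<x : ∀ p q {x y} → 0 < y → x ^ p ≡ y ^ q + 1 → 1 < x
x^p≡y^q+1⇒1<x p q {x} {y@(suc _)} _ eq with 1 <? x
... | yes 1<x = 1<x
... | no  1≮x = contradiction x^p≤1 (<⇒≱ 1<x^p)
  where
  1<x^p : 1 < x ^ p
  1<x^p = begin-strict
    1          <⟨ +-monoˡ-< 1 (m^n>0 y q) ⟩
    y ^ q + 1  ≡⟨ sym eq ⟩
    x ^ p      ∎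
    where open ≤-Reasoning
  x^p≤1 : x ^ p ≤ 1
  x^p≤1 = ≤-trans (^-monoˡ-≤ p (≮⇒≥ 1≮x)) (≤-reflexive (^-zeroˡ p))

[y+1]^q<2^[q+p]*[x∸1]^p : ∀ p q {x y} → 0 < y →
  x ^ p ≡ y ^ q + 1 → (y + 1) ^ q < 2 ^ (q + p) * (x ∸ 1) ^ p
[y+1]^q<2^[q+p]*[x∸1]^p p q {x} {y} 0<y eq = begin-strict
  (y + 1) ^ q                  ≤⟨ [n+1]^k≤2^k*n^k 0<y q ⟩
  2 ^ q * y ^ q                <⟨ *-monoʳ-< (2 ^ q) {{m^n≢0 2 q}} (m<m+n (y ^ q) z<s) ⟩
  2 ^ q * (y ^ q + 1)          ≡⟨ cong (2 ^ q *_) (sym eq) ⟩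
  2 ^ q * x ^ p                ≡⟨ cong (λ z → 2 ^ q * z ^ p) (sym (m∸n+n≡m (<⇒≤ 1<x))) ⟩
  2 ^ q * (x ∸ 1 + 1) ^ p      ≤⟨ *-monoʳ-≤ (2 ^ q) ([n+1]^k≤2^k*n^k (m<n⇒0<n∸m 1<x) p) ⟩
  2 ^ q * (2 ^ p * (x ∸ 1) ^ p) ≡⟨ *-assoc (2 ^ q) (2 ^ p) _ ⟨
  2 ^ q * 2 ^ p * (x ∸ 1) ^ p  ≡⟨ cong (_* (x ∸ 1) ^ p) (^-distribˡ-+-* 2 q p) ⟨
  2 ^ (q + p) * (x ∸ 1) ^ p    ∎
  where
  open ≤-Reasoning
  1<x : 1 < x
  1<x = x^p≡y^q+1⇒1<x p q 0<y eq

[y∸1]^q<[x+1]^p : ∀ p q {x y} .{{_ : NonZero p}} .{{_ : NonZero q}} → 0 < y →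
  x ^ p + 1 ≡ y ^ q → (y ∸ 1) ^ q < (x + 1) ^ p
[y∸1]^q<[x+1]^p p q {x} {suc y'} _ eq = begin-strict
  y' ^ q       <⟨ ^-monoˡ-< q (n<1+n y') ⟩
  suc y' ^ q   ≡⟨ eq ⟨
  x ^ p + 1    ≡⟨ +-comm (x ^ p) 1 ⟩
  1 + x ^ p    ≤⟨ ^-monoˡ-< p (m<m+n x z<s) ⟩
  (x + 1) ^ p  ∎
  where open ≤-Reasoning

mainTheorem6 : (p q x y : ℕ) → Prime p → Prime q → q < p → 2 < q → 0 < x → 0 < y →
    ((x ^ p ≡ y ^ q + 1 → (y + 1) ^ q < (x ∸ 1) ^ p * q ^ ((p ∸ 1) * q))
    × (x ^ p + 1 ≡ y ^ q → (y ∸ 1) ^ q < (x + 1) ^ p * q ^ ((p ∸ 1) * q)))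
mainTheorem6 p q x y _ _ q<p 2<q _ 0<y = minus-one , plus-one
  where
  instance
    q≢0 : NonZero q
    q≢0 = >-nonZero (m<n⇒0<n 2<q)
    p≢0 : NonZero p
    p≢0 = >-nonZero (m<n⇒0<n q<p)
  open ≤-Reasoning

  minus-one : x ^ p ≡ y ^ q + 1 → (y + 1) ^ q < (x ∸ 1) ^ p * q ^ ((p ∸ 1) * q)
  minus-one eq = begin-strict
    (y + 1) ^ q                      <⟨ [y+1]^q<2^[q+p]*[x∸1]^p p q 0<y eq ⟩
    2 ^ (q + p) * (x ∸ 1) ^ p        ≤⟨ *-monoˡ-≤ ((x ∸ 1) ^ p) (2^[n+m]≤n^[[m∸1]*n] 2<q q<p) ⟩
    q ^ ((p ∸ 1) * q) * (x ∸ 1) ^ p  ≡⟨ *-comm (q ^ ((p ∸ 1) * q)) _ ⟩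
    (x ∸ 1) ^ p * q ^ ((p ∸ 1) * q)  ∎

  plus-one : x ^ p + 1 ≡ y ^ q → (y ∸ 1) ^ q < (x + 1) ^ p * q ^ ((p ∸ 1) * q)
  plus-one eq = begin-strict
    (y ∸ 1) ^ q                      <⟨ [y∸1]^q<[x+1]^p p q 0<y eq ⟩
    (x + 1) ^ p                      ≤⟨ m≤m*n ((x + 1) ^ p) (q ^ ((p ∸ 1) * q)) {{m^n≢0 q ((p ∸ 1) * q)}} ⟩
    (x + 1) ^ p * q ^ ((p ∸ 1) * q)  ∎
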